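{- Let $M=(X,\Sigma,\delta,x_0)$ be a deterministic finite state machine such that for all $x\in X$, $\sigma,\sigma'\in\Sigma$ with $\delta(x,\sigma),\delta(x,\sigma')$ defined, $\delta(x,\sigma)=\delta(x,\sigma')$ implies $\sigma=\sigma'$, and let $G=G(M)$ be its associated game graph. Then (a) $\mathrm{Plays}(P(M))=P(G)$, (b) $\mathrm{Plays}(\mathcal{P}(M))=\mathcal{P}(G)$, and (c) $\mathrm{Plays}(\mathcal{P}(M,\mathcal{F}))=\mathcal{P}(G,\mathcal{F})$ for every Büchi, Rabin or Streett condition $\mathcal{F}$ over $M$.
   Context: $\Sigma=\Sigma_c\,\dot\cup\,\Sigma_{uc}$ finite, $\Gamma=\{\gamma\subseteq\Sigma:\Sigma_{uc}\subseteq\gamma\}$. $M$ has finite state set $X$, partial transition function $\delta:X\times\Sigma\rightharpoonup2^X$ (deterministic: defined values are singletons). Paths of $M$ are sequences $x_0x_1\dots$ with $x_{k+1}\in\delta(x_k,\sigma_k)$ for some $\sigma_k$; $P(M)$ / $\mathcal{P}(M)$ are the finite / infinite paths. For an infinite sequence $\pi$ of states, $\mathrm{Inf}(\pi)$ is the set of states occurring infinitely often. A condition over $M$ is given by subsets of $X$: Büchi $\{F\}$ (satisfied iff $\mathrm{Inf}\cap F\ne\emptyset$), Rabin $\{(G_i,R_i)\}$ (iff some $i$ has $\mathrm{Inf}\cap G_i\ne\emptyset$, $\mathrm{Inf}\cap R_i=\emptyset$), Streett $\{(G_i,R_i)\}$ (iff every $i$ has $\mathrm{Inf}\cap G_i=\emptyset$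 or $\mathrm{Inf}\cap R_i\ne\emptyset$). $\mathcal{P}(M,\mathcal{F})$ is the set of infinite paths satisfying $\mathcal{F}$. $G(M)$: player-0 states $Q^0=X$, player-1 states $Q^1=X\times\Gamma$, initial state $x_0$, $\delta^0(x)=\{x\}\times\Gamma$, and $x'\in\delta^1((x,\gamma))$ iff some $\sigma\in\gamma$ has $\delta(x,\sigma)$ defined with $x'\in\delta(x,\sigma)$. A play is a sequence starting at $x_0$ following $\delta^0$ from $Q^0$-states and $\delta^1$ from $Q^1$-states. $P(G)$ is the set of finite plays ending in $Q^0$ (i.e. in $x_0(Q^1Q^0)^*$), $\mathcal{P}(G)$ the set of infinite plays, and $\mathcal{P}(G,\mathcal{F})$ the set of infinite plays $\rho$ with $\mathrm{Inf}(\rho)$ satisfying $\mathcal{F}$ (the subsets of $X$ being regarded as subsets of $Q^0\subseteq Q^0\cup Q^1$). The map $\mathrm{Plays}$: defined on $x_0X^*$ by $\mathrm{Plays}(x_0)=\{x_0\}$ and $\mathrm{Plays}(\nu x)=\{\mu\,\tilde x\,x:\ \mu\in\mathrm{Plays}(\nu),\ \tilde x=(\mathrm{Last}(\nu),\gamma)\text{ with }\gamma\in\Gamma\text{ and }x\in\delta^1(\tilde x)\}$, where $\mathrm{Last}(\nu)$ is the last state of $\nu$. For an infinite sequence $\pi=x_0x_1\dots$, $\mathrm{Plays}(\pi)$ is the set of infinite sequences $\rho$ over $Q^0\cup Q^1$ such that for every $n$ the prefix of $\rho$ of length $2n+1$ lies in $\mathrm{Plays}(x_0\dots x_n)$. For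 a set $A$ of sequences, $\mathrm{Plays}(A)=\bigcup_{\pi\in A}\mathrm{Plays}(\pi)$. -}

module Defs where

open import Data.Nat using (ℕ; zero; suc; _≤_; _*_)
open import Data.Fin using (Fin)
open import Data.Fin.Subset using (Subset; _∈_; _⊆_)
open import Data.Maybe using (Maybe; just)
open import Data.Product using (Σ; ∃; _×_; _,_)
open import Data.Sum using (_⊎_; inj₁; inj₂)
open import Data.Unit using (⊤)
open import Data.Empty using (⊥)
open import Data.List using (List; []; _∷_; _∷ʳ_; [_]; applyUpTo)
open import Data.List.Relation.Unary.Any using (Any)
open import Data.List.Relation.Unary.All using (All)
open import Relation.Nullary using (¬_)
open import Relation.Binary.PropositionalEquality using (_≡_)
open import Relation.Unary using (Pred)
open import Level using (0ℓ)

prefix : {A : Set} → (ℕ → A) → ℕ → List A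
prefix f k = applyUpTo f k

Inf : {A : Set} → (ℕ → A) → Pred A 0ℓ
Inf π a = ∀ i → ∃ λ j → i ≤ j × π j ≡ a

data Condition (n : ℕ) : Set where
  buchi   : Subset n → Condition n
  rabin   : List (Subset n × Subset n) → Condition n
  streett : List (Subset n × Subset n) → Condition n

Sat : {n : ℕ} → Condition n → Pred (Fin n) 0ℓ → Set
Sat (buchi F)    I = ∃ λ x → x ∈ F × I x
Sat (rabin ps)   I = Any (λ { (G , R) → (∃ λ x → x ∈ G × I x) × (∀ x → x ∈ R → ¬ I x) }) ps
Sat (streett ps) I = All (λ { (G , R) → (∀ x → x ∈ G → ¬ I x) ⊎ (∃ λ x → x ∈ R × I x) }) ps

-- The machine M = (X, Σ, δ, x0) with X = Fin n, Σ = Fin m,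
-- Σuc ⊆ Σ the uncontrollable events (Σc is the complement),
-- δ partial deterministic: δ x σ ≡ just x' means δ(x,σ) = {x'}.
module FSM {n m : ℕ} (Σuc : Subset m) (δ : Fin n → Fin m → Maybe (Fin n)) (x0 : Fin n) where

  X : Set
  X = Fin n

  record Γ : Set where
    constructor mkΓ
    field
      set  : Subset m
      .sup : Σuc ⊆ set
  open Γ public

  StepM : X → X → Set
  StepM x x' = ∃ λ σ → δ x σ ≡ just x'

  ChainM : List X → Set
  ChainM []            = ⊤
  ChainM (x ∷ [])      = ⊤
  ChainM (x ∷ y ∷ l)   = StepM x y × ChainM (y ∷ l)

  PM : Pred (List X) 0ℓ
  PM []      = ⊥
  PM (x ∷ l) = x ≡ x0 × ChainM (x ∷ l)

  PathsM : Pred (ℕ → X) 0ℓ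
  PathsM π = π 0 ≡ x0 × (∀ k → StepM (π k) (π (suc k)))

  PathsMF : Condition n → Pred (ℕ → X) 0ℓ
  PathsMF F π = PathsM π × Sat F (Inf π)

  -- Game graph G(M): Q = Q⁰ ⊎ Q¹,  Q⁰ = X, Q¹ = X × Γ
  Q : Set
  Q = X ⊎ (X × Γ)

  _∈δ¹_ : X → X × Γ → Set
  x' ∈δ¹ (x , γ) = ∃ λ σ → σ ∈ set γ × δ x σ ≡ just x'

  StepG : Q → Q → Set
  StepG (inj₁ x)  q' = ∃ λ (γ : Γ) → q' ≡ inj₂ (x , γ)
  StepG (inj₂ xγ) q' = ∃ λ x' → q' ≡ inj₁ x' × x' ∈δ¹ xγ

  ChainG : List Q → Set
  ChainG []          = ⊤
  ChainG (q ∷ [])    = ⊤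
  ChainG (q ∷ r ∷ l) = StepG q r × ChainG (r ∷ l)

  EndsInQ⁰ : List Q → Set
  EndsInQ⁰ []          = ⊥
  EndsInQ⁰ (inj₁ _ ∷ []) = ⊤
  EndsInQ⁰ (inj₂ _ ∷ []) = ⊥
  EndsInQ⁰ (_ ∷ r ∷ l) = EndsInQ⁰ (r ∷ l)

  PG : Pred (List Q) 0ℓ
  PG []      = ⊥
  PG (q ∷ l) = q ≡ inj₁ x0 × ChainG (q ∷ l) × EndsInQ⁰ (q ∷ l)

  PathsG : Pred (ℕ → Q) 0ℓ
  PathsG ρ = ρ 0 ≡ inj₁ x0 × (∀ k → StepG (ρ k) (ρ (suc k)))

  InfG : (ℕ → Q) → Pred X 0ℓ
  InfG ρ x = Inf ρ (inj₁ x)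

  PathsGF : Condition n → Pred (ℕ → Q) 0ℓ
  PathsGF F ρ = PathsG ρ × Sat F (InfG ρ)

  -- Plays on x0 X*:  PlaysRel ν μ  means  μ ∈ Plays(ν)
  -- Plays(x0) = {x0};  Plays(ν x) = { μ x̃ x : μ ∈ Plays(ν), x̃ = (Last ν, γ), x ∈ δ¹(x̃) }
  data PlaysRel : List X → List Q → Set where
    base : PlaysRel [ x0 ] [ inj₁ x0 ]
    step : ∀ {ν y μ x} (γ : Γ) → PlaysRel (ν ∷ʳ y) μ → x ∈δ¹ (y , γ) →
           PlaysRel (ν ∷ʳ y ∷ʳ x) (μ ∷ʳ inj₂ (y , γ) ∷ʳ inj₁ x)

  PlaysInfRel : (ℕ → X) → (ℕ → Q) → Set
  PlaysInfRel π ρ = ∀ k → PlaysRel (prefix π (suc k)) (prefix ρ (suc (2 * k)))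

  Plays : Pred (List X) 0ℓ → Pred (List Q) 0ℓ
  Plays A μ = ∃ λ ν → A ν × PlaysRel ν μ

  PlaysInf : Pred (ℕ → X) 0ℓ → Pred (ℕ → Q) 0ℓ
  PlaysInf A ρ = ∃ λ π → A π × PlaysInfRel π ρ

-- A play of G(M) is a sequence of rounds  y (y , γ) x  with x ∈ δ¹(y , γ), and each
-- round is exactly a transition y → x of M decorated with a control pattern γ; Plays
-- inserts these decorations.  So a (finite or infinite) play is a path of M interleaved
-- with control patterns: its Q⁰-states are precisely the even positions, which spell the
-- path.  Consequently Inf of the play, read on Q⁰, equals Inf of the path, and
-- satisfaction of any Büchi, Rabin or Streett condition is the same on both sides.
module Submission where

open import Defs
open import Level using (0ℓ)
open import Data.Nat using (ℕ; zero; suc; _*_)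
open import Data.Nat.Properties using (*-suc; ≤-trans; m≤n*m; *-cancelˡ-≤)
open import Data.Fin using (Fin)
open import Data.Fin.Subset using (Subset)
open import Data.Unit using (tt)
open import Data.Product using (_×_; _,_; ∃; proj₁; proj₂)
open import Data.Sum using (inj₁; inj₂)
open import Data.Sum.Properties using (inj₁-injective)
open import Data.Maybe using (Maybe; just)
open import Data.Maybe.Properties using (just-injective)
open import Data.List using (List; []; _∷_; _∷ʳ_; last)
open import Data.List.Properties using (applyUpTo-∷ʳ)
open import Data.List.Reverse using (Reverse; []; _∶_∶ʳ_; reverseView)
import Data.List.Relation.Unary.Any as Any
import Data.List.Relation.Unary.All as All
open import Relation.Nullary using (contradiction)
open import Relation.Unary using (Pred; _≐_)
open import Relation.Unary.Properties using (≐-sym)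
open import Relation.Binary.PropositionalEquality
  using (_≡_; refl; sym; trans; cong; subst; subst₂; module ≡-Reasoning)

last-∷ʳ : ∀ {A : Set} (xs : List A) {x : A} → last (xs ∷ʳ x) ≡ just x
last-∷ʳ []           = refl
last-∷ʳ (_ ∷ [])     = refl
last-∷ʳ (_ ∷ y ∷ xs) = last-∷ʳ (y ∷ xs)

prefix-suc : ∀ {A : Set} (f : ℕ → A) k → prefix f (suc k) ≡ prefix f k ∷ʳ f k
prefix-suc f k = sym (applyUpTo-∷ʳ f k)

last-prefix : ∀ {A : Set} (f : ℕ → A) k → last (prefix f (suc k)) ≡ just (f k)
last-prefix f k rewrite prefix-suc f k = last-∷ʳ (prefix f k)

prefix-suc-2*suc : ∀ {A : Set} (f : ℕ → A) k →
  prefix f (suc (2 * suc k)) ≡ prefix f (suc (2 * k)) ∷ʳ f (suc (2 * k)) ∷ʳ f (2 * suc k)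
prefix-suc-2*suc f k = begin
  prefix f (suc (2 * suc k))
    ≡⟨ prefix-suc f (2 * suc k) ⟩
  prefix f (2 * suc k) ∷ʳ f (2 * suc k)
    ≡⟨ cong (λ j → prefix f j ∷ʳ f (2 * suc k)) (*-suc 2 k) ⟩
  prefix f (suc (suc (2 * k))) ∷ʳ f (2 * suc k)
    ≡⟨ cong (_∷ʳ f (2 * suc k)) (prefix-suc f (suc (2 * k))) ⟩
  prefix f (suc (2 * k)) ∷ʳ f (suc (2 * k)) ∷ʳ f (2 * suc k) ∎
  where open ≡-Reasoning

data EvenOdd : ℕ → Set where
  even : ∀ k → EvenOdd (2 * k)
  odd  : ∀ k → EvenOdd (suc (2 * k))

evenOdd : ∀ j → EvenOdd j
evenOdd zero = even 0
evenOdd (suc j) with evenOdd j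
... | even k = odd k
... | odd k  = subst EvenOdd (*-suc 2 k) (even (suc k))

Sat-resp-≐ : ∀ {n} (F : Condition n) {I J : Pred (Fin n) 0ℓ} → I ≐ J → Sat F I → Sat F J
Sat-resp-≐ (buchi F)    (I⊆J , _)   (x , x∈F , Ix) = x , x∈F , I⊆J Ix
Sat-resp-≐ (rabin ps)   (I⊆J , J⊆I) = Any.map λ { {G , R} ((x , x∈G , Ix) , R∩I≡∅) →
  (x , x∈G , I⊆J Ix) , λ y y∈R Jy → R∩I≡∅ y y∈R (J⊆I Jy) }
Sat-resp-≐ (streett ps) (I⊆J , J⊆I) = All.map λ
  { {G , R} (inj₁ G∩I≡∅)           → inj₁ λ y y∈G Jy → G∩I≡∅ y y∈G (J⊆I Jy)
  ; {G , R} (inj₂ (x , x∈R , Ix)) → inj₂ (x , x∈R , I⊆J Ix) }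

module Correspondence {n m : ℕ} (Σuc : Subset m) (δ : Fin n → Fin m → Maybe (Fin n)) (x0 : Fin n) where
  open FSM Σuc δ x0

  data Round : Q → Q → Q → Set where
    move : ∀ {y γ x} → x ∈δ¹ (y , γ) → Round (inj₁ y) (inj₂ (y , γ)) (inj₁ x)

  Round⇒StepG : ∀ {c a b} → Round c a b → StepG c a × StepG a b
  Round⇒StepG (move {γ = γ} {x} x∈δ¹) = (γ , refl) , (x , refl , x∈δ¹)

  Round⇒StepM : ∀ {y a x} → Round (inj₁ y) a (inj₁ x) → StepM y x
  Round⇒StepM (move (σ , _ , δyσ≡x)) = σ , δyσ≡x

  StepG⇒Round : ∀ {y a b} → StepG (inj₁ y) a → StepG a b → Round (inj₁ y) a b
  StepG⇒Round (γ , refl) (x , refl , x∈δ¹) = move x∈δ¹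

  StepG²⇒source-Q⁰ : ∀ {c a x} → StepG c a → StepG a (inj₁ x) → ∃ λ y → c ≡ inj₁ y
  StepG²⇒source-Q⁰ {inj₁ y} _ _ = y , refl
  StepG²⇒source-Q⁰ {inj₂ _} (_ , refl , _) (_ , ())

  Round-target : ∀ {c a b} → Round c a b → ∃ λ x → b ≡ inj₁ x
  Round-target (move {x = x} _) = x , refl

  ChainM-∷ʳ : ∀ l {y x} → ChainM l → last l ≡ just y → StepM y x → ChainM (l ∷ʳ x)
  ChainM-∷ʳ (_ ∷ [])        _         refl s = s , tt
  ChainM-∷ʳ (_ ∷ l@(_ ∷ _)) (s' , ch) e    s = s' , ChainM-∷ʳ l ch e s

  PM-∷ʳ : ∀ l {y x} → PM l → last l ≡ just y → StepM y x → PM (l ∷ʳ x)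
  PM-∷ʳ l@(_ ∷ _) (h≡x0 , ch) e s = h≡x0 , ChainM-∷ʳ l ch e s

  ChainG-∷ʳ⁺ : ∀ μ {c a} → ChainG μ → last μ ≡ just c → StepG c a → ChainG (μ ∷ʳ a)
  ChainG-∷ʳ⁺ (_ ∷ [])        _         refl s = s , tt
  ChainG-∷ʳ⁺ (_ ∷ μ@(_ ∷ _)) (s' , ch) e    s = s' , ChainG-∷ʳ⁺ μ ch e s

  ChainG-∷ʳ⁻ : ∀ μ {c a} → ChainG (μ ∷ʳ a) → last μ ≡ just c → ChainG μ × StepG c a
  ChainG-∷ʳ⁻ (_ ∷ [])        (s , _)   refl = tt , s
  ChainG-∷ʳ⁻ (_ ∷ μ@(_ ∷ _)) (s' , ch) e    = let ch' , s = ChainG-∷ʳ⁻ μ ch e in (s' , ch') , s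

  last⇒EndsInQ⁰ : ∀ μ {x} → last μ ≡ just (inj₁ x) → EndsInQ⁰ μ
  last⇒EndsInQ⁰ (_ ∷ [])            refl = tt
  last⇒EndsInQ⁰ (inj₁ _ ∷ μ@(_ ∷ _)) e    = last⇒EndsInQ⁰ μ e
  last⇒EndsInQ⁰ (inj₂ _ ∷ μ@(_ ∷ _)) e    = last⇒EndsInQ⁰ μ e

  EndsInQ⁰⇒last : ∀ μ → EndsInQ⁰ μ → ∃ λ x → last μ ≡ just (inj₁ x)
  EndsInQ⁰⇒last (inj₁ x ∷ [])        _ = x , refl
  EndsInQ⁰⇒last (inj₁ _ ∷ μ@(_ ∷ _)) e = EndsInQ⁰⇒last μ e
  EndsInQ⁰⇒last (inj₂ _ ∷ μ@(_ ∷ _)) e = EndsInQ⁰⇒last μ e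

  PG⇒EndsInQ⁰ : ∀ μ → PG μ → EndsInQ⁰ μ
  PG⇒EndsInQ⁰ (_ ∷ _) (_ , _ , end) = end

  PG-∷ʳ⁺ : ∀ μ {c a b} → PG μ → last μ ≡ just c → Round c a b → PG (μ ∷ʳ a ∷ʳ b)
  PG-∷ʳ⁺ μ@(_ ∷ _) (h≡x0 , ch , _) e (move {y} {γ} {x} x∈δ¹) =
    h≡x0 ,
    ChainG-∷ʳ⁺ (μ ∷ʳ a) (ChainG-∷ʳ⁺ μ {a = a} ch e (γ , refl)) (last-∷ʳ μ) (x , refl , x∈δ¹) ,
    last⇒EndsInQ⁰ (μ ∷ʳ a ∷ʳ inj₁ x) (last-∷ʳ (μ ∷ʳ a))
    where a = inj₂ (y , γ)

  PG-∷ʳ⁻ : ∀ μ {c a b} → PG (μ ∷ʳ a ∷ʳ b) → last μ ≡ just c → PG μ × Round c a b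
  PG-∷ʳ⁻ μ@(_ ∷ _) {a = a} {b} (h≡x0 , ch , end) e
    with ChainG-∷ʳ⁻ (μ ∷ʳ a) ch (last-∷ʳ μ) | EndsInQ⁰⇒last (μ ∷ʳ a ∷ʳ b) end
  ... | ch' , s₂ | x , last≡x
    with ChainG-∷ʳ⁻ μ {a = a} ch' e | just-injective (trans (sym (last-∷ʳ (μ ∷ʳ a) {b})) last≡x)
  ... | chμ , s₁ | refl with StepG²⇒source-Q⁰ s₁ s₂
  ... | y , refl = (h≡x0 , chμ , last⇒EndsInQ⁰ μ e) , StepG⇒Round s₁ s₂

  PlaysRel-last : ∀ {ν μ y} → PlaysRel ν μ → last ν ≡ just y → last μ ≡ just (inj₁ y)
  PlaysRel-last base refl = refl
  PlaysRel-last (step {ν} {y} {μ} γ _ _) e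
    with just-injective (trans (sym (last-∷ʳ (ν ∷ʳ y))) e)
  ... | refl = last-∷ʳ (μ ∷ʳ inj₂ (y , γ))

  PlaysRel⇒PG : ∀ {ν μ} → PlaysRel ν μ → PG μ
  PlaysRel⇒PG base                = refl , tt , tt
  PlaysRel⇒PG (step {ν} _ r x∈δ¹) =
    PG-∷ʳ⁺ _ (PlaysRel⇒PG r) (PlaysRel-last r (last-∷ʳ ν)) (move x∈δ¹)

  PlaysRel-round : ∀ {ν} μ {a b c} → PlaysRel ν (μ ∷ʳ a ∷ʳ b) → last μ ≡ just c → Round c a b
  PlaysRel-round μ r e = proj₂ (PG-∷ʳ⁻ μ (PlaysRel⇒PG r) e)

  PlaysRel-∷ʳ : ∀ {ν μ y a x} → PlaysRel ν μ → last ν ≡ just y → Round (inj₁ y) a (inj₁ x) →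
                PlaysRel (ν ∷ʳ x) (μ ∷ʳ a ∷ʳ inj₁ x)
  PlaysRel-∷ʳ base refl (move x∈δ¹) = step {ν = []} _ base x∈δ¹
  PlaysRel-∷ʳ r@(step {ν} {y} _ _ _) e (move x∈δ¹)
    with just-injective (trans (sym (last-∷ʳ (ν ∷ʳ y))) e)
  ... | refl = step _ r x∈δ¹

  PG⇒PlaysRel : ∀ {l y} → Reverse l → PG (l ∷ʳ inj₁ y) →
                ∃ λ ν → PM (ν ∷ʳ y) × PlaysRel (ν ∷ʳ y) (l ∷ʳ inj₁ y)
  PG⇒PlaysRel []                        (refl , _) = [] , (refl , tt) , base
  PG⇒PlaysRel (_ ∶ [] ∶ʳ _)             (refl , ((_ , ()) , _) , _)
  PG⇒PlaysRel (_ ∶ (l ∶ rl ∶ʳ _) ∶ʳ _) p with PG-∷ʳ⁻ (l ∷ʳ _) p (last-∷ʳ l)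
  ... | p' , round@(move {γ = γ} x∈δ¹) with PG⇒PlaysRel rl p'
  ... | ν , pm , r =
    ν ∷ʳ _ , PM-∷ʳ (ν ∷ʳ _) pm (last-∷ʳ ν) (Round⇒StepM round) , step γ r x∈δ¹

  PG⇒Plays : ∀ {μ} → Reverse μ → PG μ → Plays PM μ
  PG⇒Plays (_ ∶ rl ∶ʳ inj₁ y) p = let ν , pm , r = PG⇒PlaysRel rl p in ν ∷ʳ y , pm , r
  PG⇒Plays (l ∶ _ ∶ʳ inj₂ _)  p
    with trans (sym (last-∷ʳ l)) (proj₂ (EndsInQ⁰⇒last (l ∷ʳ _) (PG⇒EndsInQ⁰ (l ∷ʳ _) p)))
  ... | ()

  record Interleaving (π : ℕ → X) (ρ : ℕ → Q) : Set where
    field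
      at-even : ∀ k → ρ (2 * k) ≡ inj₁ (π k)
      round   : ∀ k → Round (inj₁ (π k)) (ρ (suc (2 * k))) (inj₁ (π (suc k)))

  module _ {π ρ} (I : Interleaving π ρ) where
    open Interleaving I

    Interleaving⇒StepG : ∀ j → StepG (ρ j) (ρ (suc j))
    Interleaving⇒StepG j with evenOdd j
    ... | even k = subst (λ q → StepG q (ρ (suc (2 * k)))) (sym (at-even k))
                         (proj₁ (Round⇒StepG (round k)))
    ... | odd k  = subst (StepG _) (sym (trans (cong ρ (sym (*-suc 2 k))) (at-even (suc k))))
                         (proj₂ (Round⇒StepG (round k)))

    Interleaving⇒StepM : ∀ k → StepM (π k) (π (suc k))
    Interleaving⇒StepM k = Round⇒StepM (round k)

    Interleaving⇒Inf≐InfG : Inf π ≐ InfG ρ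
    Interleaving⇒Inf≐InfG = Inf⊆InfG , InfG⊆Inf
      where
      Inf⊆InfG : ∀ {x} → Inf π x → InfG ρ x
      Inf⊆InfG h i = let j , i≤j , πj≡x = h i in
        2 * j , ≤-trans i≤j (m≤n*m j 2) , trans (at-even j) (cong inj₁ πj≡x)

      InfG⊆Inf : ∀ {x} → InfG ρ x → Inf π x
      InfG⊆Inf h i with h (2 * i)
      ... | j , 2i≤j , ρj≡x with evenOdd j
      ...   | even k = k , *-cancelˡ-≤ 2 2i≤j , inj₁-injective (trans (sym (at-even k)) ρj≡x)
      ...   | odd k  = contradiction (subst (λ q → Round _ q _) ρj≡x (round k)) λ ()

  PlaysInfRel⇒Interleaving : ∀ {π ρ} → PlaysInfRel π ρ → Interleaving π ρ
  PlaysInfRel⇒Interleaving {π} {ρ} rel = record { at-even = at-even ; round = round }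
    where
    at-even : ∀ k → ρ (2 * k) ≡ inj₁ (π k)
    at-even k = just-injective
      (trans (sym (last-prefix ρ (2 * k))) (PlaysRel-last (rel k) (last-prefix π k)))

    round : ∀ k → Round (inj₁ (π k)) (ρ (suc (2 * k))) (inj₁ (π (suc k)))
    round k = subst₂ (λ c b → Round c (ρ (suc (2 * k))) b) (at-even k) (at-even (suc k))
      (PlaysRel-round (prefix ρ (suc (2 * k)))
                      (subst (PlaysRel _) (prefix-suc-2*suc ρ k) (rel (suc k)))
                      (last-prefix ρ (2 * k)))

  Interleaving⇒PlaysInfRel : ∀ {π ρ} → π 0 ≡ x0 → Interleaving π ρ → PlaysInfRel π ρ
  Interleaving⇒PlaysInfRel {π} {ρ} π0≡x0 I = rel
    where
    open Interleaving I
    rel : PlaysInfRel π ρ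
    rel zero rewrite at-even 0 | π0≡x0 = base
    rel (suc k) = subst₂ PlaysRel (sym (prefix-suc π (suc k))) (sym ρ-prefix)
                         (PlaysRel-∷ʳ (rel k) (last-prefix π k) (round k))
      where
      ρ-prefix : prefix ρ (suc (2 * suc k))
               ≡ prefix ρ (suc (2 * k)) ∷ʳ ρ (suc (2 * k)) ∷ʳ inj₁ (π (suc k))
      ρ-prefix = trans (prefix-suc-2*suc ρ k)
                       (cong (prefix ρ (suc (2 * k)) ∷ʳ ρ (suc (2 * k)) ∷ʳ_) (at-even (suc k)))

  module _ {ρ} (play : PathsG ρ) where
    private
      steps : ∀ k → StepG (ρ k) (ρ (suc k))
      steps = proj₂ play

      round-from : ∀ k {y} → ρ (2 * k) ≡ inj₁ y →
                   Round (inj₁ y) (ρ (suc (2 * k))) (ρ (2 * suc k))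
      round-from k e = subst (Round _ _) (cong ρ (sym (*-suc 2 k)))
        (StepG⇒Round (subst (λ q → StepG q (ρ (suc (2 * k)))) e (steps (2 * k)))
                     (steps (suc (2 * k))))

      even-Q⁰ : ∀ k → ∃ λ y → ρ (2 * k) ≡ inj₁ y
      even-Q⁰ zero    = x0 , proj₁ play
      even-Q⁰ (suc k) = Round-target (round-from k (proj₂ (even-Q⁰ k)))

    PathsG⇒path : ℕ → X
    PathsG⇒path k = proj₁ (even-Q⁰ k)

    PathsG⇒Interleaving : Interleaving PathsG⇒path ρ
    PathsG⇒Interleaving = record
      { at-even = at-even
      ; round   = λ k → subst (Round _ _) (at-even (suc k)) (round-from k (at-even k))
      }
      where
      at-even : ∀ k → ρ (2 * k) ≡ inj₁ (PathsG⇒path k)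
      at-even k = proj₂ (even-Q⁰ k)

  PlaysInfRel⇒PathsG : ∀ {π ρ} → π 0 ≡ x0 → PlaysInfRel π ρ → PathsG ρ
  PlaysInfRel⇒PathsG {π} {ρ} π0≡x0 rel =
    trans (Interleaving.at-even I 0) (cong inj₁ π0≡x0) , Interleaving⇒StepG I
    where
    I : Interleaving π ρ
    I = PlaysInfRel⇒Interleaving rel

  PathsG⇒PathsM : ∀ {ρ} (play : PathsG ρ) → PathsM (PathsG⇒path play)
  PathsG⇒PathsM play = refl , Interleaving⇒StepM (PathsG⇒Interleaving play)

  PathsG⇒PlaysInfRel : ∀ {ρ} (play : PathsG ρ) → PlaysInfRel (PathsG⇒path play) ρ
  PathsG⇒PlaysInfRel play = Interleaving⇒PlaysInfRel refl (PathsG⇒Interleaving play)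

lemma1 : ∀ {n m : ℕ} (Σuc : Subset m) (δ : Fin n → Fin m → Maybe (Fin n)) (x0 : Fin n) →
         (∀ x σ σ' y → δ x σ ≡ just y → δ x σ' ≡ just y → σ ≡ σ') →
         (FSM.Plays Σuc δ x0 (FSM.PM Σuc δ x0) ≐ FSM.PG Σuc δ x0)
         × (FSM.PlaysInf Σuc δ x0 (FSM.PathsM Σuc δ x0) ≐ FSM.PathsG Σuc δ x0)
         × (∀ (F : Condition n) →
              FSM.PlaysInf Σuc δ x0 (FSM.PathsMF Σuc δ x0 F) ≐ FSM.PathsGF Σuc δ x0 F)
lemma1 Σuc δ x0 _ =
    ((λ (_ , _ , r) → PlaysRel⇒PG r) , λ {μ} → PG⇒Plays (reverseView μ))
  , ((λ (π , (π0≡x0 , _) , rel) → PlaysInfRel⇒PathsG {π} π0≡x0 rel)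
    , λ play → PathsG⇒path play , PathsG⇒PathsM play , PathsG⇒PlaysInfRel play)
  , λ F →
      (λ (π , ((π0≡x0 , _) , sat) , rel) →
        PlaysInfRel⇒PathsG {π} π0≡x0 rel ,
        Sat-resp-≐ F (Interleaving⇒Inf≐InfG (PlaysInfRel⇒Interleaving {π} rel)) sat)
    , λ (play , sat) →
        PathsG⇒path play ,
        (PathsG⇒PathsM play ,
         Sat-resp-≐ F (≐-sym (Interleaving⇒Inf≐InfG (PathsG⇒Interleaving play))) sat) ,
        PathsG⇒PlaysInfRel play
  where open Correspondence Σuc δ x0
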